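{- Consider the sedenions $A_4$ with canonical basis $e_0,\dots,e_{15}$, and the point-line geometry whose points are the fifteen imaginary units and whose lines are the 35 distinguished triples. Let $\alpha=\{e_3,e_5,e_6,e_7,e_9,e_{10},e_{11},e_{12},e_{13},e_{14}\}$ and $\beta=\{e_1,e_2,e_4,e_8,e_{15}\}$. Then: (i) There are exactly 10 defective triples. Each unit in $\alpha$ lies on exactly three defective and four ordinary triples. Each unit in $\beta$ lies only on ordinary triples. The ten units of $\alpha$, with the ten defective triples as lines, form a configuration isomorphic to the Desargues configuration $\mathcal{D}$. (ii) $\mathcal{D}$ has exactly 15 geometric hyperplanes. Ten of them consist of a point $p$ together with the three points not collinear with $p$. Five of them consist of six points forming a Pasch configuration. (iii) There is a bijection $\varphi$ from the fifteen imaginary units onto the geometric hyperplanes of $\mathcal{D}$ such that three distinct units form a distinguished triple if and only if their images form a line of the Veldkamp space $\mathcal{V}(\mathcal{D})$. In particular, $\mathcal{V}(\mathcal{D})\cong\mathrm{PG}(3,2)$. (iv) $\varphi$ maps the units of $\alpha$ onto the ten 4-point hyperplanes and the units of $\beta$ onto the five 6-point (Pasch) hyperplanes.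
   Context: Cayley-Dickson algebras are defined recursively by $A_0=\mathbb{R}$ and $A_{N+1}=A_N\times A_N$. On $A_{N+1}$, conjugation is $(x,y)^*=(x^*,-y)$ and multiplication is $(x,y)(X,Y)=(xX-Yy^*,\,x^*Y+Xy)$. The canonical basis $e_0,\dots,e_{2^{N+1}-1}$ of $A_{N+1}$ is given by $e_i=(e_i,0)$ and $e_{2^N+i}=(0,e_i)$ for $0\le i\le 2^N-1$. On the right-hand side, $e_i$ denotes the canonical basis of $A_N$; the basis of $A_0$ is $e_0=1$. The sedenions are $A_4$. The imaginary units of $A_N$ are $e_1,\dots,e_{2^N-1}$. A distinguished triple is a set $\{e_a,e_b,e_c\}$ of three distinct imaginary units with $e_ae_b=\pm e_c$. Write the indices so that $a<b<c$. The triple is ordinary if $a+b=c$ and defective otherwise. A geometric hyperplane of a point-line incidence structure is a proper subset $H$ of its points such that every line either has all its points in $H$ or has exactly one point in $H$. The Veldkamp space $\mathcal{V}(\mathcal{C})$ is defined as follows. Its points are the geometric hyperplanes of $\mathcal{C}$. For distinct hyperplanes $H',H''$, the Veldkamp line through them is the set of all hyperplanes $H$ with $H\in\{H',H''\}$ or $H'\cap H''=H'\cap H=H''\cap H$. The Desargues configuration is the $(10_3)$-configuration whose points are the 2-element subsets of $\{1,\dots,5\}$ and whose lines are the 3-element subsets of $\{1,\dots,5\}$. A point lies on a line when the 2-subset is contained in the 3-subset. The Pasch configuration is the analogous structure on 2-subsets and 3-subsets of a 4-element set; it is the unique $(6_2,4_3)$-configuration. $\mathrm{PG}(n,2)$ is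 the $n$-dimensional projective space over the field with two elements. -}

module Defs where

open import Data.Nat using (ℕ; zero; suc; _+_; _∸_; _^_; _<ᵇ_)
open import Data.Integer as ℤ using (ℤ; +_)
open import Data.Bool using (Bool; true; false; if_then_else_; _∨_; _xor_; T)
open import Data.Fin using (Fin; toℕ; _<_; #_) renaming (zero to f0; suc to fs)
open import Data.Fin.Subset using (Subset; _∈_; _∉_; _∩_; ∣_∣)
open import Data.Vec using (Vec; foldr; zipWith)
open import Data.List using (List; _∷_; [])
open import Data.List.Membership.Propositional using () renaming (_∈_ to _∈ₗ_)
open import Data.Product using (Σ; ∃; _×_; _,_; proj₁; proj₂)
open import Data.Sum using (_⊎_)
open import Relation.Binary.PropositionalEquality using (_≡_; _≢_)
open import Function.Definitions using (Injective)
open import Function.Bundles using (_⇔_)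
open import Relation.Nullary using (¬_)

CD : ℕ → Set
CD zero    = ℤ
CD (suc n) = CD n × CD n

cdZero : ∀ n → CD n
cdZero zero    = + 0
cdZero (suc n) = cdZero n , cdZero n

cdNeg : ∀ n → CD n → CD n
cdNeg zero    x       = ℤ.- x
cdNeg (suc n) (x , y) = cdNeg n x , cdNeg n y

cdAdd : ∀ n → CD n → CD n → CD n
cdAdd zero    x       y       = x ℤ.+ y
cdAdd (suc n) (x , y) (X , Y) = cdAdd n x X , cdAdd n y Y

cdSub : ∀ n → CD n → CD n → CD n
cdSub n x y = cdAdd n x (cdNeg n y)

cdConj : ∀ n → CD n → CD n
cdConj zero    x       = x
cdConj (suc n) (x , y) = cdConj n x , cdNeg n y

cdMul : ∀ n → CD n → CD n → CD n
cdMul zero    x       y       = x ℤ.* y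
cdMul (suc n) (x , y) (X , Y) =
  cdSub n (cdMul n x X) (cdMul n Y (cdConj n y)) ,
  cdAdd n (cdMul n (cdConj n x) Y) (cdMul n X y)

-- canonical basis e_k of A_n (meaningful for k < 2^n)
basis : ∀ n → ℕ → CD n
basis zero    zero    = + 1
basis zero    (suc _) = + 0
basis (suc n) k = if k <ᵇ 2 ^ n then (basis n k , cdZero n)
                                 else (cdZero n , basis n (k ∸ 2 ^ n))

-- The sedenion geometry: points = imaginary units e_1..e_15,
-- the unit u : Fin 15 stands for e_(u+1).

idx : Fin 15 → ℕ
idx u = suc (toℕ u)

e : Fin 15 → CD 4
e u = basis 4 (idx u)

ProdPM : Fin 15 → Fin 15 → Fin 15 → Set
ProdPM x y z = (cdMul 4 (e x) (e y) ≡ e z) ⊎ (cdMul 4 (e x) (e y) ≡ cdNeg 4 (e z))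

DistinguishedTriple : Fin 15 → Fin 15 → Fin 15 → Set
DistinguishedTriple x y z =
  x ≢ y × y ≢ z × x ≢ z ×
  (ProdPM x y z ⊎ ProdPM y x z ⊎ ProdPM x z y ⊎
   ProdPM z x y ⊎ ProdPM y z x ⊎ ProdPM z y x)

Triple : Set
Triple = Fin 15 × Fin 15 × Fin 15

IsLine : Triple → Set
IsLine (a , b , c) = a < b × b < c × DistinguishedTriple a b c

Ordinary : Triple → Set
Ordinary (a , b , c) = idx a + idx b ≡ idx c

Defective : Triple → Set
Defective (a , b , c) = idx a + idx b ≢ idx c

_∈T_ : Fin 15 → Triple → Set
u ∈T (a , b , c) = u ≡ a ⊎ u ≡ b ⊎ u ≡ c

alphaIdx betaIdx : List ℕ
alphaIdx = 3 ∷ 5 ∷ 6 ∷ 7 ∷ 9 ∷ 10 ∷ 11 ∷ 12 ∷ 13 ∷ 14 ∷ []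
betaIdx  = 1 ∷ 2 ∷ 4 ∷ 8 ∷ 15 ∷ []

InAlpha InBeta : Fin 15 → Set
InAlpha u = idx u ∈ₗ alphaIdx
InBeta  u = idx u ∈ₗ betaIdx

Exactly : {A : Set} → ℕ → (A → Set) → Set
Exactly {A} n P =
  Σ (Fin n → A) λ f → Injective _≡_ _≡_ f × (∀ i → P (f i)) ×
                      (∀ x → P x → ∃ λ i → f i ≡ x)

-- isomorphism of the incidence structure (P, L, I) onto the
-- substructure of (P', L', I') with points satisfying Q and lines
-- satisfying LT (lines compared as point sets)
EmbedIso : {P L P' L' : Set} → (P → L → Set) → (P' → L' → Set) →
           (P' → Set) → (L' → Set) → Set
EmbedIso {P} {L} {P'} {L'} _I_ _I'_ Q LT =
  Σ (P → P') λ f → Injective _≡_ _≡_ f × (∀ p → Q (f p)) ×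
    (∀ y → Q y → ∃ λ p → f p ≡ y) ×
    (∀ l → ∃ λ l' → LT l' × (∀ p → (p I l) ⇔ (f p I' l'))) ×
    (∀ l' → LT l' → ∃ λ l → (∀ p → (p I l) ⇔ (f p I' l')))

IsGH : {n : ℕ} {L : Set} → (Fin n → L → Set) → Subset n → Set
IsGH {n} {L} _I_ H =
  (∃ λ p → p ∉ H) ×
  (∀ l → (∀ p → p I l → p ∈ H) ⊎
         (∃ λ p → p I l × p ∈ H × (∀ q → q I l → q ∈ H → q ≡ p)))

-- H lies on the Veldkamp line through H' and H''
InVLine : {n : ℕ} → Subset n → Subset n → Subset n → Set
InVLine H' H'' H =
  H ≡ H' ⊎ H ≡ H'' ⊎ ((H' ∩ H'' ≡ H' ∩ H) × (H' ∩ H ≡ H'' ∩ H))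

-- Desargues configuration: points = 2-subsets {i<j} of {0..4}
-- (enumerated), lines = 3-subsets of {0..4}

dpair : Fin 10 → Fin 5 × Fin 5
dpair f0 = # 0 , # 1
dpair (fs f0) = # 0 , # 2
dpair (fs (fs f0)) = # 0 , # 3
dpair (fs (fs (fs f0))) = # 0 , # 4
dpair (fs (fs (fs (fs f0)))) = # 1 , # 2
dpair (fs (fs (fs (fs (fs f0))))) = # 1 , # 3
dpair (fs (fs (fs (fs (fs (fs f0)))))) = # 1 , # 4
dpair (fs (fs (fs (fs (fs (fs (fs f0))))))) = # 2 , # 3
dpair (fs (fs (fs (fs (fs (fs (fs (fs f0)))))))) = # 2 , # 4
dpair (fs (fs (fs (fs (fs (fs (fs (fs (fs f0))))))))) = # 3 , # 4

DLine : Set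
DLine = Σ (Subset 5) λ t → ∣ t ∣ ≡ 3

_∈D_ : Fin 10 → DLine → Set
p ∈D (t , _) = proj₁ (dpair p) ∈ t × proj₂ (dpair p) ∈ t

IsGHD : Subset 10 → Set
IsGHD = IsGH _∈D_

CollinearD : Fin 10 → Fin 10 → Set
CollinearD p q = ∃ λ l → p ∈D l × q ∈D l

PointHyp : Fin 10 → Subset 10 → Set
PointHyp p H = ∀ q → (q ∈ H) ⇔ (q ≡ p ⊎ (q ≢ p × ¬ CollinearD p q))

-- Pasch configuration: 2-subsets / 3-subsets of {0..3}
PPoint : Set
PPoint = Σ (Fin 4 × Fin 4) λ ij → proj₁ ij < proj₂ ij

PLine : Set
PLine = Σ (Subset 4) λ t → ∣ t ∣ ≡ 3

_∈P_ : PPoint → PLine → Set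
((i , j) , _) ∈P (t , _) = i ∈ t × j ∈ t

PaschShaped : Subset 10 → Set
PaschShaped H = EmbedIso _∈P_ _∈D_ (λ q → q ∈ H) (λ l → ∀ q → q ∈D l → q ∈ H)

-- Veldkamp space of D: points = geometric hyperplanes,
-- lines indexed by pairs of distinct hyperplanes
VPair : Set
VPair = Subset 10 × Subset 10

ValidVPair : VPair → Set
ValidVPair (H' , H'') = IsGHD H' × IsGHD H'' × H' ≢ H''

_∈V_ : Subset 10 → VPair → Set
H ∈V (H' , H'') = InVLine H' H'' H

FormsVLine : Subset 10 → Subset 10 → Subset 10 → Set
FormsVLine A B C =
  ∃ λ (pr : VPair) → ValidVPair pr ×
    (∀ H → IsGHD H → (H ∈V pr) ⇔ (H ≡ A ⊎ H ≡ B ⊎ H ≡ C))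

-- PG(3,2): points = nonzero vectors of F_2^4, lines {x, y, x+y}, x ≠ y

nonzeroᵇ : Vec Bool 4 → Bool
nonzeroᵇ = foldr _ _∨_ false

PGPoint : Set
PGPoint = Σ (Vec Bool 4) λ v → T (nonzeroᵇ v)

PGLine : Set
PGLine = Σ (PGPoint × PGPoint) λ xy → proj₁ xy ≢ proj₂ xy

_∈PG_ : PGPoint → PGLine → Set
p ∈PG ((x , y) , _) = p ≡ x ⊎ p ≡ y ⊎ proj₁ p ≡ zipWith _xor_ (proj₁ x) (proj₁ y)

module Submission where

-- The sedenion geometry is PG(3,2) in binary: e_a e_b = ± e_(a xor b), so the
-- distinguished triples are the lines {x, y, x ⊕ y} of nonzero vectors of F_2^4.
--  * The units of β (indices 1, 2, 4, 8, 15) form a frame f_0, ..., f_4; the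
--    Desargues configuration D sits on the units of α via {i, j} ↦ f_i ⊕ f_j.
--  * The hyperplanes of D are cut out by the symmetric bilinear form
--    B(v, w) = Σ_{i≠j} v_i w_j: φ(u) is the set of points of D whose unit is
--    B-orthogonal to u.  This correlation sends lines of PG(3,2) to Veldkamp
--    lines, which gives (iii) and V(D) ≅ PG(3,2).

open import Defs
open import Data.Nat using (ℕ)
open import Data.Fin using (Fin)
open import Data.Fin.Subset using (Subset; ∣_∣)
open import Data.Product using (Σ; ∃; _×_; _,_)
open import Data.Sum using (_⊎_)
open import Relation.Binary.PropositionalEquality using (_≡_; _≢_)
open import Function.Definitions using (Injective)
open import Function.Bundles using (_⇔_)

open import Data.Nat as N using (zero; suc; _+_; _*_; _%_; _/_; _≡ᵇ_)
import Data.Nat.Properties as NP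
import Data.Integer.Properties as ZP
open import Data.Fin as F using (#_)
import Data.Fin.Properties as FP
open import Data.Fin.Subset using (_∈_; _∩_)
import Data.Fin.Subset.Properties as SP
open import Data.Bool using (Bool; true; false; T; if_then_else_; not; _∧_; _xor_)
import Data.Bool.Properties as BP
open import Data.Vec using (Vec; []; _∷_; lookup; tabulate; zipWith; foldr)
import Data.Vec.Properties as VP
open import Data.List as List using (List; []; _∷_; allFin; cartesianProduct; concatMap; filter; length)
open import Data.List.Membership.Propositional using () renaming (_∈_ to _∈ₗ_)
open import Data.List.Membership.Propositional.Properties
  using (∈-tabulate⁺; ∈-cartesianProduct⁺; ∈-map⁺; ∈-concat⁺′; ∈-filter⁺; ∈-lookup)
open import Data.List.Membership.DecPropositional NP._≟_ using () renaming (_∈?_ to _∈ℕ?_)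
import Data.List.Relation.Unary.All as All
import Data.List.Relation.Unary.Any as Any
open import Data.List.Relation.Unary.Any using (here; there)
open import Data.List.Relation.Unary.All.Properties using (all-filter)
open import Data.List.Relation.Unary.Any.Properties using (lookup-index)
open import Data.Product using (proj₁; proj₂; uncurry)
import Data.Product.Properties as ×P
open import Data.Sum using (inj₁; inj₂)
import Data.Sum as Sum
open import Function.Bundles using (mk⇔; Equivalence)
open import Function.Properties.Equivalence using () renaming (trans to ⇔-trans; sym to ⇔-sym)
open import Relation.Binary.PropositionalEquality
  using (refl; sym; trans; cong; cong₂; subst; subst₂; module ≡-Reasoning)
open import Relation.Binary.Definitions using (DecidableEquality)
open import Relation.Nullary using (Dec; yes; no; ¬_; does; Irrelevant; contradiction)
open import Relation.Nullary.Decidable using (_×-dec_; _⊎-dec_; _→-dec_; ¬?; map′; toWitness; dec-true)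
open import Relation.Unary using (Decidable)

-- Quantifiers
-- over such a type are decidable; a fact about finitely many objects is then
-- proved as 'toWitness {a? = d} _', which typechecks exactly when the decision
-- procedure d evaluates to 'yes'.
record Listing (A : Set) : Set where
  field
    elements : List A
    complete : ∀ x → x ∈ₗ elements
open Listing

module _ {A : Set} (L : Listing A) {P : A → Set} (P? : Decidable P) where

  ∀? : Dec (∀ x → P x)
  ∀? = map′ (λ ps x → All.lookup ps (complete L x)) (λ h → All.tabulate (λ {x} _ → h x))
            (All.all? P? (elements L))

  ∃? : Dec (∃ P)
  ∃? = map′ Any.satisfied (λ (x , px) → Any.map (λ x≡y → subst P x≡y px) (complete L x))
            (Any.any? P? (elements L))

  satisfying : List A
  satisfying = filter P? (elements L)

  exactly-satisfying : Injective _≡_ _≡_ (List.lookup satisfying) → Exactly (length satisfying) P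
  exactly-satisfying inj =
    List.lookup satisfying , inj ,
    (λ i → All.lookup (all-filter P? (elements L)) (∈-lookup i)) ,
    λ x px → let x∈ = ∈-filter⁺ P? (complete L x) px in Any.index x∈ , sym (lookup-index x∈)

finListing : ∀ n → Listing (Fin n)
finListing n = record { elements = allFin n ; complete = ∈-tabulate⁺ }

injective? : ∀ {A : Set} {n} → DecidableEquality A → (f : Fin n → A) → Dec (Injective _≡_ _≡_ f)
injective? {n = n} _≟_ f = map′ (λ h {i} {j} → h i j) (λ h i j → h)
  (∀? (finListing n) λ i → ∀? (finListing n) λ j → f i ≟ f j →-dec i FP.≟ j)

module _ {A : Set} (L : Listing A) (_≟_ : DecidableEquality A) {P : A → Set} (P? : Decidable P) where

  CountsTo : ℕ → Set
  CountsTo n = length (satisfying L P?) ≡ n × Injective _≡_ _≡_ (List.lookup (satisfying L P?))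

  countsTo? : ∀ n → Dec (CountsTo n)
  countsTo? n = length (satisfying L P?) NP.≟ n ×-dec injective? _≟_ (List.lookup (satisfying L P?))

  exactly : ∀ {n} → CountsTo n → Exactly n P
  exactly (refl , inj) = exactly-satisfying L P? inj

boolListing : Listing Bool
boolListing = record
  { elements = true ∷ false ∷ []
  ; complete = λ { true → here refl ; false → there (here refl) } }

×-listing : ∀ {A B : Set} → Listing A → Listing B → Listing (A × B)
×-listing LA LB = record
  { elements = cartesianProduct (elements LA) (elements LB)
  ; complete = λ (a , b) → ∈-cartesianProduct⁺ (complete LA a) (complete LB b) }

vecListing : ∀ {A : Set} → Listing A → ∀ n → Listing (Vec A n)
vecListing LA zero    = record { elements = [] ∷ [] ; complete = λ { [] → here refl } }
vecListing LA (suc n) = record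
  { elements = List.map (uncurry _∷_) (elements LA×Vec)
  ; complete = λ { (x ∷ xs) → ∈-map⁺ (uncurry _∷_) (complete LA×Vec (x , xs)) } }
  where LA×Vec = ×-listing LA (vecListing LA n)

subsetListing : ∀ n → Listing (Subset n)
subsetListing = vecListing boolListing

Σ-listing : ∀ {A : Set} {Q : A → Set} → Listing A → Decidable Q → (∀ {a} → Irrelevant (Q a)) →
            Listing (Σ A Q)
Σ-listing {A} {Q} LA Q? irr = record
  { elements = concatMap (λ a → withProof a (Q? a)) (elements LA)
  ; complete = λ (a , q) →
      ∈-concat⁺′ (listed a q (Q? a)) (∈-map⁺ (λ a → withProof a (Q? a)) (complete LA a)) }
  where
  withProof : (a : A) → Dec (Q a) → List (Σ A Q)
  withProof a (yes q) = (a , q) ∷ []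
  withProof a (no _)  = []
  listed : ∀ a q (d : Dec (Q a)) → (a , q) ∈ₗ withProof a d
  listed a q (yes q′) = here (cong (a ,_) (irr q q′))
  listed a q (no ¬q)  = contradiction q ¬q

Σ-≟ : ∀ {A : Set} {Q : A → Set} → DecidableEquality A → (∀ {a} → Irrelevant (Q a)) →
      DecidableEquality (Σ A Q)
Σ-≟ _≟_ irr = ×P.≡-dec _≟_ (λ q q′ → yes (irr q q′))

_⇔?_ : ∀ {A B : Set} → Dec A → Dec B → Dec (A ⇔ B)
yes a ⇔? yes b = yes (mk⇔ (λ _ → b) (λ _ → a))
yes a ⇔? no ¬b = no (λ a⇔b → ¬b (Equivalence.to a⇔b a))
no ¬a ⇔? yes b = no (λ a⇔b → ¬a (Equivalence.from a⇔b b))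
no ¬a ⇔? no ¬b = yes (mk⇔ (λ a → contradiction a ¬a) (λ b → contradiction b ¬b))

EmbedIsoVia : {P L P' L' : Set} → (P → L → Set) → (P' → L' → Set) → (P' → Set) → (L' → Set) →
              (P → P') → Set
EmbedIsoVia {P} {L} {P'} {L'} _I_ _I'_ Q LT f =
  Injective _≡_ _≡_ f × (∀ p → Q (f p)) ×
    (∀ y → Q y → ∃ λ p → f p ≡ y) ×
    (∀ l → ∃ λ l' → LT l' × (∀ p → (p I l) ⇔ (f p I' l'))) ×
    (∀ l' → LT l' → ∃ λ l → (∀ p → (p I l) ⇔ (f p I' l')))

embedIsoVia? : ∀ {P L P' L' : Set} {_I_ : P → L → Set} {_I'_ : P' → L' → Set}
  {Q : P' → Set} {LT : L' → Set} →
  Listing P → DecidableEquality P → Listing L → Listing P' → DecidableEquality P' → Listing L' →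
  (∀ p l → Dec (p I l)) → (∀ p l → Dec (p I' l)) → Decidable Q → Decidable LT →
  (f : P → P') → Dec (EmbedIsoVia _I_ _I'_ Q LT f)
embedIsoVia? LP _≟P_ LL LP' _≟P'_ LL' I? I'? Q? LT? f =
  map′ (λ h {x} {y} → h x y) (λ h x y → h)
    (∀? LP λ x → ∀? LP λ y → f x ≟P' f y →-dec x ≟P y) ×-dec
  ∀? LP (λ p → Q? (f p)) ×-dec
  ∀? LP' (λ y → Q? y →-dec ∃? LP (λ p → f p ≟P' y)) ×-dec
  ∀? LL (λ l → ∃? LL' λ l' → LT? l' ×-dec sameIncidence l l') ×-dec
  ∀? LL' (λ l' → LT? l' →-dec ∃? LL λ l → sameIncidence l l')
  where sameIncidence = λ l l' → ∀? LP (λ p → I? p l ⇔? I'? (f p) l')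

-- The binary picture: a unit e_k corresponds to the little-endian binary
-- digits of k, a nonzero vector of F_2^4, and ⊕ is addition of these vectors.

binary : (n : ℕ) → ℕ → Vec Bool n
binary zero    k = []
binary (suc n) k = (k % 2 ≡ᵇ 1) ∷ binary n (k / 2)

fromBinary : ∀ {n} → Vec Bool n → ℕ
fromBinary []      = 0
fromBinary (b ∷ v) = (if b then 1 else 0) + 2 * fromBinary v

-- the unit e_k, for 1 ≤ k ≤ 15 (other k give e_1; they never arise below)
unitAt : ℕ → Fin 15
unitAt zero = F.zero
unitAt (suc k) with k N.<? 15
... | yes k<15 = F.fromℕ< k<15
... | no _     = F.zero

bits : Fin 15 → Vec Bool 4
bits u = binary 4 (idx u)

unitOf : Vec Bool 4 → Fin 15
unitOf v = unitAt (fromBinary v)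

infixl 6 _⊕_
_⊕_ : Fin 15 → Fin 15 → Fin 15
u ⊕ v = unitOf (zipWith _xor_ (bits u) (bits v))

units : Listing (Fin 15)
units = finListing 15

abstract
  ⊕-comm : ∀ x y → x ⊕ y ≡ y ⊕ x
  ⊕-comm = toWitness {a? = ∀? units λ x → ∀? units λ y → x ⊕ y FP.≟ y ⊕ x} _

  ⊕-cancel : ∀ x y → x ≢ y → x ⊕ (x ⊕ y) ≡ y
  ⊕-cancel = toWitness {a? = ∀? units λ x → ∀? units λ y → ¬? (x FP.≟ y) →-dec x ⊕ (x ⊕ y) FP.≟ y} _

  ⊕-new : ∀ x y → x ≢ y → x ⊕ y ≢ x
  ⊕-new = toWitness {a? = ∀? units λ x → ∀? units λ y → ¬? (x FP.≟ y) →-dec ¬? (x ⊕ y FP.≟ x)} _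

≢-sym : ∀ {A : Set} {a b : A} → a ≢ b → b ≢ a
≢-sym a≢b b≡a = a≢b (sym b≡a)

cd-≟ : ∀ n → DecidableEquality (CD n)
cd-≟ zero    = ZP._≟_
cd-≟ (suc n) = ×P.≡-dec (cd-≟ n) (cd-≟ n)

cdNeg-involutive : ∀ n (x : CD n) → cdNeg n (cdNeg n x) ≡ x
cdNeg-involutive zero    x       = ZP.neg-involutive x
cdNeg-involutive (suc n) (x , y) = cong₂ _,_ (cdNeg-involutive n x) (cdNeg-involutive n y)

SignedUnit : CD 4 → Fin 15 → Set
SignedUnit m z = (m ≡ e z) ⊎ (m ≡ cdNeg 4 (e z))

signedUnit? : ∀ m z → Dec (SignedUnit m z)
signedUnit? m z = cd-≟ 4 m (e z) ⊎-dec cd-≟ 4 m (cdNeg 4 (e z))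

abstract
  productLaw : ∀ x y → x ≢ y → SignedUnit (cdMul 4 (e x) (e y)) (x ⊕ y)
  productLaw = toWitness {a? = ∀? units λ x → ∀? units λ y →
    ¬? (x FP.≟ y) →-dec signedUnit? (cdMul 4 (e x) (e y)) (x ⊕ y)} _

  e-injective : ∀ z w → e z ≡ e w → z ≡ w
  e-injective = toWitness {a? = ∀? units λ z → ∀? units λ w → cd-≟ 4 (e z) (e w) →-dec z FP.≟ w} _

  e≢-e : ∀ z w → e z ≢ cdNeg 4 (e w)
  e≢-e = toWitness {a? = ∀? units λ z → ∀? units λ w → ¬? (cd-≟ 4 (e z) (cdNeg 4 (e w)))} _

-e-injective : ∀ z w → cdNeg 4 (e z) ≡ cdNeg 4 (e w) → z ≡ w
-e-injective z w eq = e-injective z w (begin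
  e z                      ≡⟨ cdNeg-involutive 4 (e z) ⟨
  cdNeg 4 (cdNeg 4 (e z))  ≡⟨ cong (cdNeg 4) eq ⟩
  cdNeg 4 (cdNeg 4 (e w))  ≡⟨ cdNeg-involutive 4 (e w) ⟩
  e w                      ∎)
  where open ≡-Reasoning

signedUnit-unique : ∀ {m z w} → SignedUnit m z → SignedUnit m w → z ≡ w
signedUnit-unique {z = z} {w} (inj₁ p) (inj₁ q) = e-injective z w (trans (sym p) q)
signedUnit-unique {z = z} {w} (inj₁ p) (inj₂ q) = contradiction (trans (sym p) q) (e≢-e z w)
signedUnit-unique {z = z} {w} (inj₂ p) (inj₁ q) = contradiction (trans (sym q) p) (e≢-e w z)
signedUnit-unique {z = z} {w} (inj₂ p) (inj₂ q) = -e-injective z w (trans (sym p) q)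

prodPM⇒ : ∀ x y z → x ≢ y → ProdPM x y z → z ≡ x ⊕ y
prodPM⇒ x y z x≢y p = signedUnit-unique p (productLaw x y x≢y)

prodPM⇐ : ∀ x y {z} → x ≢ y → z ≡ x ⊕ y → ProdPM x y z
prodPM⇐ x y x≢y refl = productLaw x y x≢y

BinaryLine : Fin 15 → Fin 15 → Fin 15 → Set
BinaryLine x y z = x ≢ y × y ≢ z × x ≢ z × z ≡ x ⊕ y

-- the two transpositions generating the symmetries of the relation z = x ⊕ y
swap₁₂ : ∀ x y {z} → z ≡ x ⊕ y → z ≡ y ⊕ x
swap₁₂ x y z≡ = trans z≡ (⊕-comm x y)

swap₂₃ : ∀ x y {z} → x ≢ y → z ≡ x ⊕ y → y ≡ x ⊕ z
swap₂₃ x y x≢y refl = sym (⊕-cancel x y x≢y)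

distinguished⇔binaryLine : ∀ x y z → DistinguishedTriple x y z ⇔ BinaryLine x y z
distinguished⇔binaryLine x y z =
  mk⇔ toLine (λ (xy , yz , xz , z≡) → xy , yz , xz , inj₁ (prodPM⇐ x y xy z≡))
  where
  toLine : DistinguishedTriple x y z → BinaryLine x y z
  toLine (xy , yz , xz , products) = xy , yz , xz , fromProduct products
    where
    fromProduct : ProdPM x y z ⊎ ProdPM y x z ⊎ ProdPM x z y ⊎
                  ProdPM z x y ⊎ ProdPM y z x ⊎ ProdPM z y x → z ≡ x ⊕ y
    fromProduct (inj₁ p)                             = prodPM⇒ x y z xy p
    fromProduct (inj₂ (inj₁ p))                      = swap₁₂ y x (prodPM⇒ y x z (≢-sym xy) p)
    fromProduct (inj₂ (inj₂ (inj₁ p)))               = swap₂₃ x z xz (prodPM⇒ x z y xz p)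
    fromProduct (inj₂ (inj₂ (inj₂ (inj₁ p))))        =
      swap₂₃ x z xz (swap₁₂ z x (prodPM⇒ z x y (≢-sym xz) p))
    fromProduct (inj₂ (inj₂ (inj₂ (inj₂ (inj₁ p))))) = swap₁₂ y x (swap₂₃ y z yz (prodPM⇒ y z x yz p))
    fromProduct (inj₂ (inj₂ (inj₂ (inj₂ (inj₂ p))))) =
      swap₁₂ y x (swap₂₃ y z yz (swap₁₂ z y (prodPM⇒ z y x (≢-sym yz) p)))

binaryLine? : ∀ x y z → Dec (BinaryLine x y z)
binaryLine? x y z = ¬? (x FP.≟ y) ×-dec ¬? (y FP.≟ z) ×-dec ¬? (x FP.≟ z) ×-dec z FP.≟ x ⊕ y

-- Part (i): the defective triples and the Desargues configuration on α.

-- lines are decided through the binary picture rather than by multiplying sedenions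
isLine? : ∀ t → Dec (IsLine t)
isLine? (a , b , c) =
  a FP.<? b ×-dec b FP.<? c ×-dec
  map′ (Equivalence.from (distinguished⇔binaryLine a b c)) (Equivalence.to (distinguished⇔binaryLine a b c))
       (binaryLine? a b c)

ordinary? : ∀ t → Dec (Ordinary t)
ordinary? (a , b , c) = idx a + idx b NP.≟ idx c

defective? : ∀ t → Dec (Defective t)
defective? t = ¬? (ordinary? t)

defectiveLine? : ∀ t → Dec (IsLine t × Defective t)
defectiveLine? t = isLine? t ×-dec defective? t

∈T? : ∀ u t → Dec (u ∈T t)
∈T? u (a , b , c) = u FP.≟ a ⊎-dec u FP.≟ b ⊎-dec u FP.≟ c

inAlpha? : ∀ u → Dec (InAlpha u)
inAlpha? u = idx u ∈ℕ? alphaIdx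

inBeta? : ∀ u → Dec (InBeta u)
inBeta? u = idx u ∈ℕ? betaIdx

triples : Listing Triple
triples = ×-listing units (×-listing units units)

triple-≟ : DecidableEquality Triple
triple-≟ = ×P.≡-dec FP._≟_ (×P.≡-dec FP._≟_ FP._≟_)

abstract
  defectiveLineCount : Exactly 10 (λ t → IsLine t × Defective t)
  defectiveLineCount = exactly triples triple-≟ defectiveLine?
    (toWitness {a? = countsTo? triples triple-≟ defectiveLine? 10} _)

  alphaLineCounts : ∀ u → InAlpha u →
    CountsTo triples triple-≟ (λ t → isLine? t ×-dec defective? t ×-dec ∈T? u t) 3 ×
    CountsTo triples triple-≟ (λ t → isLine? t ×-dec ordinary? t ×-dec ∈T? u t) 4
  alphaLineCounts = toWitness {a? = ∀? units λ u → inAlpha? u →-dec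
    (countsTo? triples triple-≟ (λ t → isLine? t ×-dec defective? t ×-dec ∈T? u t) 3 ×-dec
     countsTo? triples triple-≟ (λ t → isLine? t ×-dec ordinary? t ×-dec ∈T? u t) 4)} _

  betaOnlyOrdinary : ∀ u → InBeta u → ∀ t → IsLine t → u ∈T t → Ordinary t
  betaOnlyOrdinary = toWitness {a? = ∀? units λ u → inBeta? u →-dec
    ∀? triples λ t → isLine? t →-dec ∈T? u t →-dec ordinary? t} _

alphaLines : ∀ u → InAlpha u →
  Exactly 3 (λ t → IsLine t × Defective t × u ∈T t) × Exactly 4 (λ t → IsLine t × Ordinary t × u ∈T t)
alphaLines u α =
  exactly triples triple-≟ (λ t → isLine? t ×-dec defective? t ×-dec ∈T? u t) (proj₁ (alphaLineCounts u α)) ,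
  exactly triples triple-≟ (λ t → isLine? t ×-dec ordinary? t ×-dec ∈T? u t) (proj₂ (alphaLineCounts u α))

dpoints : Listing (Fin 10)
dpoints = finListing 10

dlines : Listing DLine
dlines = Σ-listing (subsetListing 5) (λ t → ∣ t ∣ NP.≟ 3) NP.≡-irrelevant

∈D? : ∀ p l → Dec (p ∈D l)
∈D? p (t , _) = proj₁ (dpair p) SP.∈? t ×-dec proj₂ (dpair p) SP.∈? t

-- the frame e_1, e_2, e_4, e_8, e_15 formed by the units of β
frame : Fin 5 → Fin 15
frame = lookup (# 0 ∷ # 1 ∷ # 3 ∷ # 7 ∷ # 14 ∷ [])

ι : Fin 10 → Fin 15
ι p = frame (proj₁ (dpair p)) ⊕ frame (proj₂ (dpair p))

abstract
  desarguesEmbedding : EmbedIsoVia _∈D_ _∈T_ InAlpha (λ t → IsLine t × Defective t) ι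
  desarguesEmbedding = toWitness {a? = embedIsoVia? dpoints FP._≟_ dlines units FP._≟_ triples
    ∈D? ∈T? inAlpha? defectiveLine? ι} _

-- Part (ii): the geometric hyperplanes of D.

subset-≟ : ∀ {n} → DecidableEquality (Subset n)
subset-≟ = VP.≡-dec BP._≟_

isGHD? : ∀ H → Dec (IsGHD H)
isGHD? H = ∃? dpoints (λ p → ¬? (p SP.∈? H)) ×-dec
  ∀? dlines (λ l → ∀? dpoints (λ p → ∈D? p l →-dec p SP.∈? H) ⊎-dec
                   ∃? dpoints (λ p → ∈D? p l ×-dec p SP.∈? H ×-dec
                     ∀? dpoints λ q → ∈D? q l →-dec q SP.∈? H →-dec q FP.≟ p))

parity : ∀ {n} → Vec Bool n → Bool
parity = foldr _ _xor_ false

-- the symmetric bilinear form B(v, w) = Σ_{i≠j} v_i w_j = (Σ v)(Σ w) + Σ v_i w_i over F_2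
form : ∀ {n} → Vec Bool n → Vec Bool n → Bool
form v w = (parity v ∧ parity w) xor parity (zipWith _∧_ v w)

φ : Fin 15 → Subset 10
φ u = tabulate λ p → not (form (bits u) (bits (ι p)))

abstract
  φ-injective : Injective _≡_ _≡_ φ
  φ-injective = toWitness {a? = injective? subset-≟ φ} _

  φ-hyperplane : ∀ u → IsGHD (φ u)
  φ-hyperplane = toWitness {a? = ∀? units λ u → isGHD? (φ u)} _

  φ-surjective : ∀ H → IsGHD H → ∃ λ u → φ u ≡ H
  φ-surjective = toWitness {a? = ∀? (subsetListing 10) λ H → isGHD? H →-dec
    ∃? units λ u → subset-≟ (φ u) H} _

hyperplaneCount : Exactly 15 IsGHD
hyperplaneCount = φ , φ-injective , φ-hyperplane , φ-surjective

does-true⇒ : ∀ {A : Set} (a? : Dec A) → does a? ≡ true → A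
does-true⇒ (yes a) _  = a
does-true⇒ (no _)  ()

∈-select : ∀ {n} {P : Fin n → Set} (P? : Decidable P) q → (q ∈ tabulate (λ r → does (P? r))) ⇔ P q
∈-select P? q = mk⇔ (λ q∈ → does-true⇒ (P? q) (trans (sym lookup-select) (VP.[]=⇒lookup q∈)))
                     (λ pq → VP.lookup⇒[]= q _ (trans lookup-select (dec-true (P? q) pq)))
  where
  lookup-select : lookup (tabulate (λ r → does (P? r))) q ≡ does (P? q)
  lookup-select = VP.lookup∘tabulate _ q

subset-ext : ∀ {n} {H H′ : Subset n} → (∀ q → (q ∈ H) ⇔ (q ∈ H′)) → H ≡ H′
subset-ext H⇔H′ = SP.⊆-antisym (λ {q} → Equivalence.to (H⇔H′ q)) (λ {q} → Equivalence.from (H⇔H′ q))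

collinearD? : ∀ p q → Dec (CollinearD p q)
collinearD? p q = ∃? dlines λ l → ∈D? p l ×-dec ∈D? q l

sameOrNotCollinear? : ∀ p q → Dec (q ≡ p ⊎ (q ≢ p × ¬ CollinearD p q))
sameOrNotCollinear? p q = q FP.≟ p ⊎-dec (¬? (q FP.≟ p) ×-dec ¬? (collinearD? p q))

pointHyperplane : Fin 10 → Subset 10
pointHyperplane p = tabulate λ q → does (sameOrNotCollinear? p q)

pointHyperplane-spec : ∀ p → PointHyp p (pointHyperplane p)
pointHyperplane-spec p = ∈-select (sameOrNotCollinear? p)

pointHyp-unique : ∀ {p H} → PointHyp p H → H ≡ pointHyperplane p
pointHyp-unique {p} spec = subset-ext λ q →
  ⇔-trans (spec q) (⇔-sym (pointHyperplane-spec p q))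

abstract
  pointHyperplane-injective : Injective _≡_ _≡_ pointHyperplane
  pointHyperplane-injective = toWitness {a? = injective? subset-≟ pointHyperplane} _

  pointHyperplane-shape : ∀ p → IsGHD (pointHyperplane p) × ∣ pointHyperplane p ∣ ≡ 4
  pointHyperplane-shape = toWitness {a? = ∀? dpoints λ p →
    isGHD? (pointHyperplane p) ×-dec ∣ pointHyperplane p ∣ NP.≟ 4} _

pointHyperplanes : Exactly 10 (λ H → IsGHD H × ∣ H ∣ ≡ 4 × ∃ λ p → PointHyp p H)
pointHyperplanes =
  pointHyperplane , pointHyperplane-injective ,
  (λ p → let (gh , card) = pointHyperplane-shape p in gh , card , p , pointHyperplane-spec p) ,
  λ { H (_ , _ , p , spec) → p , sym (pointHyp-unique spec) }

avoids? : ∀ k p → Dec (proj₁ (dpair p) ≢ k × proj₂ (dpair p) ≢ k)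
avoids? k p = ¬? (proj₁ (dpair p) FP.≟ k) ×-dec ¬? (proj₂ (dpair p) FP.≟ k)

paschHyperplane : Fin 5 → Subset 10
paschHyperplane k = tabulate λ p → does (avoids? k p)

-- the point {i, j} of D, for i < j (found by search; the fallback is never reached)
pairPoint : Fin 5 → Fin 5 → Fin 10
pairPoint i j with ∃? dpoints (λ p → ×P.≡-dec FP._≟_ FP._≟_ (dpair p) (i , j))
... | yes (p , _) = p
... | no _        = F.zero

-- relabel {0, 1, 2, 3} as {0, ..., 4} ∖ {k}, monotonically
paschMap : Fin 5 → PPoint → Fin 10
paschMap k ((i , j) , _) = pairPoint (F.punchIn k i) (F.punchIn k j)

ppoints : Listing PPoint
ppoints = Σ-listing (×-listing (finListing 4) (finListing 4)) (λ (i , j) → i FP.<? j) NP.<-irrelevant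

plines : Listing PLine
plines = Σ-listing (subsetListing 4) (λ t → ∣ t ∣ NP.≟ 3) NP.≡-irrelevant

∈P? : ∀ p l → Dec (p ∈P l)
∈P? ((i , j) , _) (t , _) = i SP.∈? t ×-dec j SP.∈? t

abstract
  paschHyperplane-injective : Injective _≡_ _≡_ paschHyperplane
  paschHyperplane-injective = toWitness {a? = injective? subset-≟ paschHyperplane} _

  paschHyperplane-shape : ∀ k → IsGHD (paschHyperplane k) × ∣ paschHyperplane k ∣ ≡ 6 ×
    EmbedIsoVia _∈P_ _∈D_ (λ q → q ∈ paschHyperplane k) (λ l → ∀ q → q ∈D l → q ∈ paschHyperplane k)
                (paschMap k)
  paschHyperplane-shape = toWitness {a? = ∀? (finListing 5) λ k →
    isGHD? (paschHyperplane k) ×-dec ∣ paschHyperplane k ∣ NP.≟ 6 ×-dec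
    embedIsoVia? ppoints (Σ-≟ (×P.≡-dec FP._≟_ FP._≟_) NP.<-irrelevant) plines dpoints FP._≟_ dlines
      ∈P? ∈D? (λ q → q SP.∈? paschHyperplane k)
      (λ l → ∀? dpoints λ q → ∈D? q l →-dec q SP.∈? paschHyperplane k) (paschMap k)} _

  sixPointHyperplanesArePasch : ∀ u → ∣ φ u ∣ ≡ 6 → ∃ λ k → paschHyperplane k ≡ φ u
  sixPointHyperplanesArePasch = toWitness {a? = ∀? units λ u → ∣ φ u ∣ NP.≟ 6 →-dec
    ∃? (finListing 5) λ k → subset-≟ (paschHyperplane k) (φ u)} _

paschHyperplanes : Exactly 5 (λ H → IsGHD H × ∣ H ∣ ≡ 6 × PaschShaped H)
paschHyperplanes =
  paschHyperplane , paschHyperplane-injective ,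
  (λ k → let (gh , card , pasch) = paschHyperplane-shape k in gh , card , (paschMap k , pasch)) ,
  λ H (gh , card , _) → paschOf H (φ-surjective H gh) card
  where
  paschOf : ∀ H → (∃ λ u → φ u ≡ H) → ∣ H ∣ ≡ 6 → ∃ λ k → paschHyperplane k ≡ H
  paschOf .(φ u) (u , refl) = sixPointHyperplanesArePasch u

-- Parts (iii) and (iv): φ carries the lines {a, b, a ⊕ b} onto the Veldkamp lines.

∈V? : ∀ H pr → Dec (H ∈V pr)
∈V? H (H′ , H″) = subset-≟ H H′ ⊎-dec subset-≟ H H″ ⊎-dec
  (subset-≟ (H′ ∩ H″) (H′ ∩ H) ×-dec subset-≟ (H′ ∩ H) (H″ ∩ H))

abstract
  veldkampLines : ∀ a b → a ≢ b → ∀ u → (φ u ∈V (φ a , φ b)) ⇔ (u ∈T (a , b , a ⊕ b))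
  veldkampLines = toWitness {a? = ∀? units λ a → ∀? units λ b → ¬? (a FP.≟ b) →-dec
    ∀? units λ u → ∈V? (φ u) (φ a , φ b) ⇔? ∈T? u (a , b , a ⊕ b)} _

  alphaToFourPoints : ∀ u → InAlpha u → ∣ φ u ∣ ≡ 4
  alphaToFourPoints = toWitness {a? = ∀? units λ u → inAlpha? u →-dec ∣ φ u ∣ NP.≟ 4} _

  betaToSixPoints : ∀ u → InBeta u → ∣ φ u ∣ ≡ 6
  betaToSixPoints = toWitness {a? = ∀? units λ u → inBeta? u →-dec ∣ φ u ∣ NP.≟ 6} _

φ-∈T : ∀ {u x y z} → (φ u ≡ φ x ⊎ φ u ≡ φ y ⊎ φ u ≡ φ z) ⇔ (u ∈T (x , y , z))
φ-∈T = mk⇔ (Sum.map φ-injective (Sum.map φ-injective φ-injective))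
           (Sum.map (cong φ) (Sum.map (cong φ) (cong φ)))

cancel-across : ∀ a b → a ≢ b → b ⊕ (a ⊕ b) ≡ a
cancel-across a b a≢b = trans (cong (b ⊕_) (⊕-comm a b)) (⊕-cancel b a (≢-sym a≢b))

line-closed : ∀ {a b x y} → a ≢ b → x ≢ y →
  x ∈T (a , b , a ⊕ b) → y ∈T (a , b , a ⊕ b) → (x ⊕ y) ∈T (a , b , a ⊕ b)
line-closed         a≢b x≢y (inj₁ refl)        (inj₂ (inj₁ refl)) = inj₂ (inj₂ refl)
line-closed {a} {b} a≢b x≢y (inj₁ refl)        (inj₂ (inj₂ refl)) = inj₂ (inj₁ (⊕-cancel a b a≢b))
line-closed {a} {b} a≢b x≢y (inj₂ (inj₁ refl)) (inj₁ refl)        = inj₂ (inj₂ (⊕-comm b a))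
line-closed {a} {b} a≢b x≢y (inj₂ (inj₁ refl)) (inj₂ (inj₂ refl)) = inj₁ (cancel-across a b a≢b)
line-closed {a} {b} a≢b x≢y (inj₂ (inj₂ refl)) (inj₁ refl)        =
  inj₂ (inj₁ (trans (⊕-comm (a ⊕ b) a) (⊕-cancel a b a≢b)))
line-closed {a} {b} a≢b x≢y (inj₂ (inj₂ refl)) (inj₂ (inj₁ refl)) =
  inj₁ (trans (⊕-comm (a ⊕ b) b) (cancel-across a b a≢b))
line-closed a≢b x≢y (inj₁ refl)        (inj₁ refl)        = contradiction refl x≢y
line-closed a≢b x≢y (inj₂ (inj₁ refl)) (inj₂ (inj₁ refl)) = contradiction refl x≢y
line-closed a≢b x≢y (inj₂ (inj₂ refl)) (inj₂ (inj₂ refl)) = contradiction refl x≢y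

binaryLine⇒vLine : ∀ {x y z} → BinaryLine x y z → FormsVLine (φ x) (φ y) (φ z)
binaryLine⇒vLine {x} {y} (x≢y , _ , _ , refl) =
  (φ x , φ y) , (φ-hyperplane x , φ-hyperplane y , λ φx≡φy → x≢y (φ-injective φx≡φy)) ,
  λ H gh → members H (φ-surjective H gh)
  where
  members : ∀ H → (∃ λ u → φ u ≡ H) → (H ∈V (φ x , φ y)) ⇔ (H ≡ φ x ⊎ H ≡ φ y ⊎ H ≡ φ (x ⊕ y))
  members .(φ u) (u , refl) = ⇔-trans (veldkampLines x y x≢y u) (⇔-sym φ-∈T)

-- If a Veldkamp line has the points φ(x), φ(y), φ(z), it is the line through
-- φ(a), φ(b) for some a ≠ b, so {x, y, z} = {a, b, a ⊕ b}; since x ⊕ y lies on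
-- that line and differs from x and y, it is z.
vLine⇒binaryLine : ∀ {x y z} → x ≢ y → y ≢ z → x ≢ z →
  FormsVLine (φ x) (φ y) (φ z) → BinaryLine x y z
vLine⇒binaryLine {x} {y} {z} x≢y y≢z x≢z ((H′ , H″) , (gh′ , gh″ , H′≢H″) , members) =
  through (φ-surjective H′ gh′) (φ-surjective H″ gh″)
  where
  through : (∃ λ a → φ a ≡ H′) → (∃ λ b → φ b ≡ H″) → BinaryLine x y z
  through (a , refl) (b , refl) = x≢y , y≢z , x≢z , sym (third x⊕y-on-xyz)
    where
    a≢b : a ≢ b
    a≢b a≡b = H′≢H″ (cong φ a≡b)
    sameLine : ∀ u → (u ∈T (a , b , a ⊕ b)) ⇔ (u ∈T (x , y , z))
    sameLine u = ⇔-trans (⇔-sym (veldkampLines a b a≢b u)) (⇔-trans (members (φ u) (φ-hyperplane u)) φ-∈T)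
    x⊕y-on-xyz : (x ⊕ y) ∈T (x , y , z)
    x⊕y-on-xyz = Equivalence.to (sameLine (x ⊕ y))
      (line-closed a≢b x≢y (Equivalence.from (sameLine x) (inj₁ refl))
                           (Equivalence.from (sameLine y) (inj₂ (inj₁ refl))))
    third : (x ⊕ y) ∈T (x , y , z) → x ⊕ y ≡ z
    third (inj₁ eq)        = contradiction eq (⊕-new x y x≢y)
    third (inj₂ (inj₁ eq)) = contradiction (trans (⊕-comm y x) eq) (⊕-new y x (≢-sym x≢y))
    third (inj₂ (inj₂ eq)) = eq

distinguished⇔vLine : ∀ x y z → x ≢ y → y ≢ z → x ≢ z →
  DistinguishedTriple x y z ⇔ FormsVLine (φ x) (φ y) (φ z)
distinguished⇔vLine x y z x≢y y≢z x≢z =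
  ⇔-trans (distinguished⇔binaryLine x y z) (mk⇔ binaryLine⇒vLine (vLine⇒binaryLine x≢y y≢z x≢z))

-- V(D) ≅ PG(3,2): a point of PG(3,2) is the binary expansion of a unit.

pgUnit : PGPoint → Fin 15
pgUnit (v , _) = unitOf v

pgPoints : Listing PGPoint
pgPoints = Σ-listing (vecListing boolListing 4) (λ v → BP.T? (nonzeroᵇ v)) BP.T-irrelevant

abstract
  bits-nonzero : ∀ u → T (nonzeroᵇ (bits u))
  bits-nonzero = toWitness {a? = ∀? units λ u → BP.T? (nonzeroᵇ (bits u))} _

  unitOf-bits : ∀ u → unitOf (bits u) ≡ u
  unitOf-bits = toWitness {a? = ∀? units λ u → unitOf (bits u) FP.≟ u} _

  bits-pgUnit : ∀ p → bits (pgUnit p) ≡ proj₁ p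
  bits-pgUnit = toWitness {a? = ∀? pgPoints λ p → VP.≡-dec BP._≟_ (bits (pgUnit p)) (proj₁ p)} _

  bits-⊕ : ∀ x y → x ≢ y → bits (x ⊕ y) ≡ zipWith _xor_ (bits x) (bits y)
  bits-⊕ = toWitness {a? = ∀? units λ x → ∀? units λ y → ¬? (x FP.≟ y) →-dec
    VP.≡-dec BP._≟_ (bits (x ⊕ y)) (zipWith _xor_ (bits x) (bits y))} _

pgPoint : Fin 15 → PGPoint
pgPoint u = bits u , bits-nonzero u

pgUnit-injective : ∀ {p q} → pgUnit p ≡ pgUnit q → p ≡ q
pgUnit-injective {p@(v , _)} {q} eq
  with trans (sym (bits-pgUnit p)) (trans (cong bits eq) (bits-pgUnit q))
... | refl = cong (v ,_) (BP.T-irrelevant _ _)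

pgUnit-⊕ : ∀ p {x y} → x ≢ y →
  (proj₁ p ≡ zipWith _xor_ (proj₁ x) (proj₁ y)) ⇔ (pgUnit p ≡ pgUnit x ⊕ pgUnit y)
pgUnit-⊕ p {x} {y} x≢y = mk⇔ to from
  where
  open ≡-Reasoning
  to : proj₁ p ≡ zipWith _xor_ (proj₁ x) (proj₁ y) → pgUnit p ≡ pgUnit x ⊕ pgUnit y
  to eq = begin
    unitOf (proj₁ p)                                           ≡⟨ cong unitOf eq ⟩
    unitOf (zipWith _xor_ (proj₁ x) (proj₁ y))                 ≡⟨ cong₂ (λ v w → unitOf (zipWith _xor_ v w))
                                                                        (bits-pgUnit x) (bits-pgUnit y) ⟨
    unitOf (zipWith _xor_ (bits (pgUnit x)) (bits (pgUnit y))) ∎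
  from : pgUnit p ≡ pgUnit x ⊕ pgUnit y → proj₁ p ≡ zipWith _xor_ (proj₁ x) (proj₁ y)
  from eq = begin
    proj₁ p                                            ≡⟨ bits-pgUnit p ⟨
    bits (pgUnit p)                                    ≡⟨ cong bits eq ⟩
    bits (pgUnit x ⊕ pgUnit y)                         ≡⟨ bits-⊕ _ _ (λ e → x≢y (pgUnit-injective e)) ⟩
    zipWith _xor_ (bits (pgUnit x)) (bits (pgUnit y))  ≡⟨ cong₂ (zipWith _xor_) (bits-pgUnit x) (bits-pgUnit y) ⟩
    zipWith _xor_ (proj₁ x) (proj₁ y)                  ∎

pgHyperplane : PGPoint → Subset 10
pgHyperplane p = φ (pgUnit p)

pgHyperplane-pgPoint : ∀ u → pgHyperplane (pgPoint u) ≡ φ u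
pgHyperplane-pgPoint u = cong φ (unitOf-bits u)

pgLine-membership : ∀ x y (x≢y : x ≢ y) p →
  (p ∈PG ((x , y) , x≢y)) ⇔ (pgHyperplane p ∈V (pgHyperplane x , pgHyperplane y))
pgLine-membership x y x≢y p =
  ⇔-trans (mk⇔ (Sum.map (cong pgUnit) (Sum.map (cong pgUnit) (Equivalence.to (pgUnit-⊕ p x≢y))))
               (Sum.map pgUnit-injective (Sum.map pgUnit-injective (Equivalence.from (pgUnit-⊕ p x≢y)))))
          (⇔-sym (veldkampLines (pgUnit x) (pgUnit y) (λ e → x≢y (pgUnit-injective e)) (pgUnit p)))

pgVeldkamp : EmbedIso _∈PG_ _∈V_ IsGHD ValidVPair
pgVeldkamp =
  pgHyperplane , (λ eq → pgUnit-injective (φ-injective eq)) , (λ p → φ-hyperplane (pgUnit p)) ,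
  (λ H gh → fromUnit H (φ-surjective H gh)) ,
  (λ { ((x , y) , x≢y) → (pgHyperplane x , pgHyperplane y) ,
         (φ-hyperplane (pgUnit x) , φ-hyperplane (pgUnit y) ,
          λ eq → x≢y (pgUnit-injective (φ-injective eq))) ,
         pgLine-membership x y x≢y }) ,
  λ { (H′ , H″) (gh′ , gh″ , H′≢H″) → lineOf (φ-surjective H′ gh′) (φ-surjective H″ gh″) H′≢H″ }
  where
  fromUnit : ∀ H → (∃ λ u → φ u ≡ H) → ∃ λ p → pgHyperplane p ≡ H
  fromUnit .(φ u) (u , refl) = pgPoint u , pgHyperplane-pgPoint u
  lineOf : ∀ {H′ H″} → (∃ λ a → φ a ≡ H′) → (∃ λ b → φ b ≡ H″) → H′ ≢ H″ →
           ∃ λ (l : PGLine) → ∀ p → (p ∈PG l) ⇔ (pgHyperplane p ∈V (H′ , H″))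
  lineOf (a , refl) (b , refl) φa≢φb =
    ((pgPoint a , pgPoint b) , a≢b) ,
    subst₂ (λ A B → ∀ p → (p ∈PG ((pgPoint a , pgPoint b) , a≢b)) ⇔ (pgHyperplane p ∈V (A , B)))
           (pgHyperplane-pgPoint a) (pgHyperplane-pgPoint b) (pgLine-membership _ _ a≢b)
    where
    a≢b : pgPoint a ≢ pgPoint b
    a≢b eq = φa≢φb (trans (sym (pgHyperplane-pgPoint a))
                          (trans (cong pgHyperplane eq) (pgHyperplane-pgPoint b)))

mainTheorem2 :
    ( Exactly 10 (λ t → IsLine t × Defective t)
    × (∀ u → InAlpha u →
         Exactly 3 (λ t → IsLine t × Defective t × u ∈T t)
         × Exactly 4 (λ t → IsLine t × Ordinary t × u ∈T t))
    × (∀ u → InBeta u → ∀ t → IsLine t → u ∈T t → Ordinary t)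
    × EmbedIso _∈D_ _∈T_ InAlpha (λ t → IsLine t × Defective t) )
    × ( Exactly 15 IsGHD
      × Exactly 10 (λ H → IsGHD H × ∣ H ∣ ≡ 4 × ∃ λ p → PointHyp p H)
      × Exactly 5 (λ H → IsGHD H × ∣ H ∣ ≡ 6 × PaschShaped H) )
    × ( Σ (Fin 15 → Subset 10) λ φ →
          Injective _≡_ _≡_ φ
          × (∀ u → IsGHD (φ u))
          × (∀ H → IsGHD H → ∃ λ u → φ u ≡ H)
          × (∀ x y z → x ≢ y → y ≢ z → x ≢ z →
               DistinguishedTriple x y z ⇔ FormsVLine (φ x) (φ y) (φ z))
          × (∀ u → InAlpha u → ∣ φ u ∣ ≡ 4)
          × (∀ u → InBeta u → ∣ φ u ∣ ≡ 6) )
    × EmbedIso _∈PG_ _∈V_ IsGHD ValidVPair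
mainTheorem2 =
  (defectiveLineCount , alphaLines , betaOnlyOrdinary , (ι , desarguesEmbedding)) ,
  (hyperplaneCount , pointHyperplanes , paschHyperplanes) ,
  (φ , φ-injective , φ-hyperplane , φ-surjective , distinguished⇔vLine , alphaToFourPoints , betaToSixPoints) ,
  pgVeldkamp
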